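{- Let $d$ be a positive integer and $\chi$ a primitive Dirichlet character of conductor $d$. Let $w_1,w_2,w_3$ be any positive integers and $n\ge0$ an integer. Then \begin{align*} &\sum_{k+l+m=n}\binom{n}{k,l,m}S_{k}(w_{1}d-1,\chi)S_{l}(w_{2}d-1,\chi)S_{m}(w_{3}d-1,\chi)w_{3}^{k-1}w_{1}^{l-1}w_{2}^{m-1}\\ =&\sum_{k+l+m=n}\binom{n}{k,l,m}S_{k}(w_{1}d-1,\chi)S_{l}(w_{3}d-1,\chi)S_{m}(w_{2}d-1,\chi)w_{2}^{k-1}w_{1}^{l-1}w_{3}^{m-1}. \end{align*}
   Context: The character $\chi$ is regarded as a function on integers (periodic mod $d$, with $\chi(a)=0$ when $\gcd(a,d)>1$; for $d=1$, $\chi\equiv 1$), with values in $\overline{\mathbb{Q}}$. The generalized power sum is $S_k(N,\chi)=\sum_{a=0}^{N}\chi(a)a^k$ (with $0^0=1$). Sums are over nonnegative integers $k,l,m$ with $k+l+m=n$, and $\binom{n}{k,l,m}=\frac{n!}{k!l!m!}$. -}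

module Defs where

open import Level using (Level; _⊔_) renaming (suc to lsuc)
open import Data.Nat as ℕ using (ℕ; zero; suc; _∸_; _<_; ∣_-_∣; NonZero; _!)
open import Data.Nat.Properties using (_!≢0; m*n≢0)
open import Data.Nat.DivMod using (_/_)
open import Data.Nat.Divisibility using (_∣_)
open import Data.Nat.GCD using (gcd)
open import Data.Nat.Coprimality using (Coprime)
open import Algebra.Bundles using (CommutativeRing)
open import Relation.Nullary using (¬_)
open import Relation.Binary.PropositionalEquality using (_≡_; _≢_)

module RingOps {c ℓ : Level} (R : CommutativeRing c ℓ) where
  open CommutativeRing R

  ι : ℕ → Carrier
  ι zero = 0#
  ι (suc n) = 1# + ι n

  pow : Carrier → ℕ → Carrier
  pow x zero = 1#
  pow x (suc k) = x * pow x k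

  sumTo : ℕ → (ℕ → Carrier) → Carrier
  sumTo zero f = f 0
  sumTo (suc N) f = sumTo N f + f (suc N)

record CharZeroField (c ℓ : Level) : Set (lsuc (c ⊔ ℓ)) where
  field
    commutativeRing : CommutativeRing c ℓ
    _⁻¹ : CommutativeRing.Carrier commutativeRing → CommutativeRing.Carrier commutativeRing
    inverseʳ : ∀ x → ¬ (CommutativeRing._≈_ commutativeRing x (CommutativeRing.0# commutativeRing))
             → CommutativeRing._≈_ commutativeRing
                 (CommutativeRing._*_ commutativeRing x (x ⁻¹)) (CommutativeRing.1# commutativeRing)
    charZero : ∀ n → ¬ (CommutativeRing._≈_ commutativeRing
                          (RingOps.ι commutativeRing (suc n)) (CommutativeRing.0# commutativeRing))
  open CommutativeRing commutativeRing public
  open RingOps commutativeRing public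

module _ {c ℓ : Level} (F : CharZeroField c ℓ) where
  open CharZeroField F

  -- χ : ℕ → F is a Dirichlet character modulo d
  -- (values on nonnegative integers suffice since χ is d-periodic)
  record IsDirichletCharacter (d : ℕ) (χ : ℕ → Carrier) : Set (c ⊔ ℓ) where
    field
      periodic       : ∀ a → χ (a ℕ.+ d) ≈ χ a
      multiplicative : ∀ a b → χ (a ℕ.* b) ≈ (χ a * χ b)
      one            : χ 1 ≈ 1#
      vanish         : ∀ a → gcd a d ≢ 1 → χ a ≈ 0#

  InducedMod : (d : ℕ) (χ : ℕ → Carrier) (e : ℕ) → Set ℓ
  InducedMod d χ e = ∀ a → Coprime a d → e ∣ ∣ a - 1 ∣ → χ a ≈ 1#

  record IsPrimitiveCharacter (d : ℕ) (χ : ℕ → Carrier) : Set (c ⊔ ℓ) where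
    field
      isCharacter : IsDirichletCharacter d χ
      noSmallerModulus : ∀ e → e ∣ d → e < d → ¬ InducedMod d χ e

  -- generalized power sum S_k(N, χ) = Σ_{a=0}^{N} χ(a) a^k   (0^0 = 1)
  S : ℕ → ℕ → (ℕ → Carrier) → Carrier
  S k N χ = sumTo N (λ a → χ a * pow (ι a) k)

  -- w^(k-1) in F, so that w^(0-1) = w⁻¹
  wpow : ℕ → ℕ → Carrier
  wpow w zero = (ι w) ⁻¹
  wpow w (suc j) = pow (ι w) j

  sum3 : ℕ → (ℕ → ℕ → ℕ → Carrier) → Carrier
  sum3 n f = sumTo n (λ k → sumTo (n ∸ k) (λ l → f k l (n ∸ k ∸ l)))

multinomial : ℕ → ℕ → ℕ → ℕ → ℕ
multinomial n k l m =
  _/_ (n !) ((k ! ℕ.* l !) ℕ.* m !)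
      {{m*n≢0 (k ! ℕ.* l !) (m !) {{m*n≢0 (k !) (l !) {{k !≢0}} {{l !≢0}}}} {{m !≢0}}}}

{-# OPTIONS --safe #-}
module Submission where

-- Multiplying by w₁w₂w₃ turns each w^(k-1) into w^k, and the multinomial theorem then
-- identifies the left-hand side with
--   T(w₁,w₂,w₃) = Σ_{a<w₁d, b<w₂d, c<w₃d} χ(a)χ(b)χ(c) (w₃a + w₁b + w₂c)ⁿ ,
-- so it suffices that T is symmetric in w₂ and w₃.  Read T as a composite of shift-sum
-- operators g ↦ Σ_a κ(a) g(x + σ(a)) applied to s ↦ sⁿ at 0; such operators commute.
-- Every function is a difference, so sⁿ = Δ_{w₃d} Δ_{w₁d} Δ_{w₂d} G with Δ_m g(x) = g(x+m) - g(x),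
-- and since χ has period d, Σ_{a<ud} χ(a) Δ_{vd}g(x+va) telescopes to Σ_{a<d} χ(a) Δ_{uvd}g(x+va).
-- This pairs each character sum with one difference operator and leaves six commuting operators
-- whose multiset is invariant under w₂ ↔ w₃.  It is the denominator-free form of
-- Σ_{a<ud} χ(a) e^{vat} = (e^{uvdt} - 1)/(e^{vdt} - 1) · Σ_{a<d} χ(a) e^{vat};
-- only the periodicity of χ is used, not its primitivity.

open import Defs
open import Level using (Level)
import Data.Nat as ℕ
open import Data.Nat using (ℕ; zero; suc; NonZero; _∸_; _>_; _≤_; _<_; s≤s; _!; >-nonZero)
import Data.Nat.Properties as ℕₚ
open import Data.Nat.Properties using (_!≢0; _!*_!≢0; m*n≢0)
open import Data.Nat.DivMod
  using (_/_; _%_; m/n≡1+[m∸n]/n; [m+n]%n≡m%n; m≡m%n+[m/n]*n; m*n/n≡m; m/n*n≡m)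
open import Data.Nat.Combinatorics using (_C_; nCk≡n!/k![n-k]!; k![n∸k]!∣n!)
open import Data.Nat.Tactic.RingSolver using (solve-∀)
open import Data.Fin using (toℕ)
open import Data.List using (List; []; _∷_)
open import Data.List.Relation.Binary.Permutation.Propositional as Perm using (_↭_)
open import Data.List.Relation.Binary.Permutation.Propositional.Properties
  using (shift; ↭-reverse; ++⁺ʳ)
open import Data.Maybe using (nothing)
open import Relation.Nullary using (¬_)
open import Relation.Binary.PropositionalEquality as P using (_≡_)
open import Algebra.Bundles using (CommutativeRing)
import Algebra.Solver.Ring.NaturalCoefficients as NaturalCoefficients
import Algebra.Properties.CommutativeSemiring.Binomial as Binomial
import Algebra.Properties.Semiring.Sum as SemiringSum
import Algebra.Properties.Semiring.Mult as SemiringMult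
import Algebra.Properties.Semiring.Exp as SemiringExp
import Algebra.Properties.CommutativeSemigroup as CommutativeSemigroupProperties

n!≡nCk*[k!*[n∸k]!] : ∀ {n k} → k ≤ n → n ! ≡ (n C k) ℕ.* (k ! ℕ.* (n ∸ k) !)
n!≡nCk*[k!*[n∸k]!] {n} {k} k≤n = P.sym (P.trans
  (P.cong (ℕ._* (k ! ℕ.* (n ∸ k) !)) (nCk≡n!/k![n-k]! k≤n))
  (m/n*n≡m {{k !* (n ∸ k) !≢0}} (k![n∸k]!∣n! k≤n)))

multinomial≡C*C : ∀ {n k l} → k ≤ n → l ≤ n ∸ k →
                  multinomial n k l (n ∸ k ∸ l) ≡ (n C k) ℕ.* ((n ∸ k) C l)
multinomial≡C*C {n} {k} {l} k≤n l≤n∸k = P.trans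
  (P.cong (λ t → (t / denominator) {{denominator≢0}}) n!≡C*C*denominator)
  (m*n/n≡m ((n C k) ℕ.* ((n ∸ k) C l)) denominator {{denominator≢0}})
  where
  denominator = (k ! ℕ.* l !) ℕ.* (n ∸ k ∸ l) !
  denominator≢0 = m*n≢0 (k ! ℕ.* l !) ((n ∸ k ∸ l) !) {{k !* l !≢0}} {{(n ∸ k ∸ l) !≢0}}
  reassociate : ∀ a b x y z → a ℕ.* (x ℕ.* (b ℕ.* (y ℕ.* z))) ≡ (a ℕ.* b) ℕ.* ((x ℕ.* y) ℕ.* z)
  reassociate = solve-∀
  n!≡C*C*denominator : n ! ≡ ((n C k) ℕ.* ((n ∸ k) C l)) ℕ.* denominator
  n!≡C*C*denominator = P.trans (n!≡nCk*[k!*[n∸k]!] k≤n) (P.trans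
    (P.cong (λ t → (n C k) ℕ.* (k ! ℕ.* t)) (n!≡nCk*[k!*[n∸k]!] l≤n∸k))
    (reassociate (n C k) ((n ∸ k) C l) (k !) (l !) ((n ∸ k ∸ l) !)))

interleave : ∀ {a} {A : Set a} (x₁ x₂ x₃ y₁ y₂ y₃ : A) →
             x₁ ∷ x₂ ∷ x₃ ∷ y₁ ∷ y₂ ∷ y₃ ∷ [] ↭ x₁ ∷ y₁ ∷ x₂ ∷ y₂ ∷ x₃ ∷ y₃ ∷ []
interleave x₁ x₂ x₃ y₁ y₂ y₃ = Perm.prep x₁ (Perm.trans
  (shift y₁ (x₂ ∷ x₃ ∷ []) (y₂ ∷ y₃ ∷ []))
  (Perm.prep y₁ (Perm.prep x₂ (shift y₂ (x₃ ∷ []) (y₃ ∷ [])))))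

module SumsAndPowers {c ℓ : Level} (R : CommutativeRing c ℓ) where
  open CommutativeRing R
  open RingOps R
  open import Relation.Binary.Reasoning.Setoid setoid
  open NaturalCoefficients commutativeSemiring (λ _ _ → nothing) using (solve; _:=_; _:+_; _:*_)
  open CommutativeSemigroupProperties +-commutativeSemigroup using () renaming (interchange to +-interchange)
  open CommutativeSemigroupProperties *-commutativeSemigroup using () renaming (interchange to *-interchange)

  Σ< : ℕ → (ℕ → Carrier) → Carrier
  Σ< zero    f = 0#
  Σ< (suc n) f = f 0 + Σ< n (λ a → f (suc a))

  Σ<-cong : ∀ n {f g : ℕ → Carrier} → (∀ a → f a ≈ g a) → Σ< n f ≈ Σ< n g
  Σ<-cong zero    f≈g = refl
  Σ<-cong (suc n) f≈g = +-cong (f≈g 0) (Σ<-cong n (λ a → f≈g (suc a)))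

  Σ<-cong-< : ∀ n {f g : ℕ → Carrier} → (∀ a → a < n → f a ≈ g a) → Σ< n f ≈ Σ< n g
  Σ<-cong-< zero    f≈g = refl
  Σ<-cong-< (suc n) f≈g =
    +-cong (f≈g 0 (s≤s ℕ.z≤n)) (Σ<-cong-< n (λ a a<n → f≈g (suc a) (s≤s a<n)))

  Σ<-zero : ∀ n → Σ< n (λ _ → 0#) ≈ 0#
  Σ<-zero zero    = refl
  Σ<-zero (suc n) = trans (+-identityˡ _) (Σ<-zero n)

  Σ<-distrib-+ : ∀ n (f g : ℕ → Carrier) → Σ< n (λ a → f a + g a) ≈ Σ< n f + Σ< n g
  Σ<-distrib-+ zero    f g = sym (+-identityʳ 0#)
  Σ<-distrib-+ (suc n) f g = trans
    (+-congˡ (Σ<-distrib-+ n (λ a → f (suc a)) (λ a → g (suc a))))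
    (+-interchange _ _ _ _)

  *-distribˡ-Σ< : ∀ n x (f : ℕ → Carrier) → x * Σ< n f ≈ Σ< n (λ a → x * f a)
  *-distribˡ-Σ< zero    x f = zeroʳ x
  *-distribˡ-Σ< (suc n) x f = trans (distribˡ x _ _) (+-congˡ (*-distribˡ-Σ< n x _))

  *-distribʳ-Σ< : ∀ n x (f : ℕ → Carrier) → Σ< n f * x ≈ Σ< n (λ a → f a * x)
  *-distribʳ-Σ< zero    x f = zeroˡ x
  *-distribʳ-Σ< (suc n) x f = trans (distribʳ x _ _) (+-congˡ (*-distribʳ-Σ< n x _))

  Σ<-swap : ∀ m n (f : ℕ → ℕ → Carrier) →
            Σ< m (λ a → Σ< n (f a)) ≈ Σ< n (λ b → Σ< m (λ a → f a b))
  Σ<-swap zero    n f = sym (Σ<-zero n)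
  Σ<-swap (suc m) n f = trans
    (+-congˡ (Σ<-swap m n (λ a → f (suc a))))
    (sym (Σ<-distrib-+ n (f 0) _))

  Σ<-split : ∀ m n (f : ℕ → Carrier) → Σ< (m ℕ.+ n) f ≈ Σ< m f + Σ< n (λ a → f (m ℕ.+ a))
  Σ<-split zero    n f = sym (+-identityˡ _)
  Σ<-split (suc m) n f = trans (+-congˡ (Σ<-split m n (λ a → f (suc a)))) (sym (+-assoc _ _ _))

  Σ<-suc : ∀ n (f : ℕ → Carrier) → Σ< (suc n) f ≈ Σ< n f + f n
  Σ<-suc zero    f = trans (+-identityʳ _) (sym (+-identityˡ _))
  Σ<-suc (suc n) f = trans (+-congˡ (Σ<-suc n (λ a → f (suc a)))) (sym (+-assoc _ _ _))

  Σ<-blocks : ∀ u d (f : ℕ → Carrier) →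
              Σ< (u ℕ.* d) f ≈ Σ< u (λ j → Σ< d (λ i → f (j ℕ.* d ℕ.+ i)))
  Σ<-blocks zero    d f = refl
  Σ<-blocks (suc u) d f = trans (Σ<-split d (u ℕ.* d) f) (+-congˡ (begin
    Σ< (u ℕ.* d) (λ a → f (d ℕ.+ a))
      ≈⟨ Σ<-blocks u d (λ a → f (d ℕ.+ a)) ⟩
    Σ< u (λ j → Σ< d (λ i → f (d ℕ.+ (j ℕ.* d ℕ.+ i))))
      ≈⟨ Σ<-cong u (λ j → Σ<-cong d (λ i → reflexive (P.cong f (P.sym (ℕₚ.+-assoc d (j ℕ.* d) i))))) ⟩
    Σ< u (λ j → Σ< d (λ i → f (suc j ℕ.* d ℕ.+ i))) ∎))

  -‿telescope : ∀ a b c → (b - a) + (c - b) ≈ c - a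
  -‿telescope a b c = begin
    (b - a) + (c - b)   ≈⟨ solve 4 (λ b c -a -b → (b :+ -a) :+ (c :+ -b) := (c :+ -a) :+ (b :+ -b)) refl b c (- a) (- b) ⟩
    (c - a) + (b - b)   ≈⟨ +-congˡ (-‿inverseʳ b) ⟩
    (c - a) + 0#        ≈⟨ +-identityʳ _ ⟩
    c - a               ∎

  Σ<-telescope : ∀ u (F : ℕ → Carrier) → Σ< u (λ j → F (suc j) - F j) ≈ F u - F 0
  Σ<-telescope zero    F = sym (-‿inverseʳ (F 0))
  Σ<-telescope (suc u) F = begin
    (F 1 - F 0) + Σ< u (λ j → F (suc (suc j)) - F (suc j))
      ≈⟨ +-congˡ (Σ<-telescope u (λ j → F (suc j))) ⟩
    (F 1 - F 0) + (F (suc u) - F 1)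
      ≈⟨ -‿telescope (F 0) (F 1) (F (suc u)) ⟩
    F (suc u) - F 0 ∎

  sumTo≈Σ< : ∀ N (f : ℕ → Carrier) → sumTo N f ≈ Σ< (suc N) f
  sumTo≈Σ< zero    f = sym (+-identityʳ _)
  sumTo≈Σ< (suc N) f = trans (+-congʳ (sumTo≈Σ< N f)) (sym (Σ<-suc (suc N) f))

  Σ₃ : ℕ → (ℕ → ℕ → ℕ → Carrier) → Carrier
  Σ₃ n f = Σ< (suc n) (λ k → Σ< (suc (n ∸ k)) (λ l → f k l (n ∸ k ∸ l)))

  Σ₃-cong : ∀ n {f g : ℕ → ℕ → ℕ → Carrier} → (∀ k l m → f k l m ≈ g k l m) → Σ₃ n f ≈ Σ₃ n g
  Σ₃-cong n f≈g = Σ<-cong (suc n) (λ k → Σ<-cong (suc (n ∸ k)) (λ l → f≈g k l (n ∸ k ∸ l)))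

  *-distribˡ-Σ₃ : ∀ n x (f : ℕ → ℕ → ℕ → Carrier) → x * Σ₃ n f ≈ Σ₃ n (λ k l m → x * f k l m)
  *-distribˡ-Σ₃ n x f = trans (*-distribˡ-Σ< (suc n) x (λ k → Σ< (suc (n ∸ k)) (λ l → f k l (n ∸ k ∸ l))))
    (Σ<-cong (suc n) (λ k → *-distribˡ-Σ< (suc (n ∸ k)) x (λ l → f k l (n ∸ k ∸ l))))

  Σ₃-Σ<-swap : ∀ n N (f : ℕ → ℕ → ℕ → ℕ → Carrier) →
               Σ₃ n (λ k l m → Σ< N (f k l m)) ≈ Σ< N (λ a → Σ₃ n (λ k l m → f k l m a))
  Σ₃-Σ<-swap n N f = trans
    (Σ<-cong (suc n) (λ k → Σ<-swap (suc (n ∸ k)) N (λ l → f k l (n ∸ k ∸ l))))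
    (Σ<-swap (suc n) N (λ k a → Σ< (suc (n ∸ k)) (λ l → f k l (n ∸ k ∸ l) a)))

  ι-+ : ∀ m n → ι (m ℕ.+ n) ≈ ι m + ι n
  ι-+ zero    n = sym (+-identityˡ _)
  ι-+ (suc m) n = trans (+-congˡ (ι-+ m n)) (sym (+-assoc _ _ _))

  ι-* : ∀ m n → ι (m ℕ.* n) ≈ ι m * ι n
  ι-* zero    n = sym (zeroˡ _)
  ι-* (suc m) n = begin
    ι (n ℕ.+ m ℕ.* n)       ≈⟨ ι-+ n (m ℕ.* n) ⟩
    ι n + ι (m ℕ.* n)       ≈⟨ +-cong (sym (*-identityˡ _)) (ι-* m n) ⟩
    1# * ι n + ι m * ι n    ≈⟨ sym (distribʳ _ _ _) ⟩
    (1# + ι m) * ι n        ∎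

  pow-cong : ∀ {x y} k → x ≈ y → pow x k ≈ pow y k
  pow-cong zero    x≈y = refl
  pow-cong (suc k) x≈y = *-cong x≈y (pow-cong k x≈y)

  pow-distrib-* : ∀ x y k → pow (x * y) k ≈ pow x k * pow y k
  pow-distrib-* x y zero    = sym (*-identityˡ _)
  pow-distrib-* x y (suc k) = trans (*-congˡ (pow-distrib-* x y k)) (*-interchange x y _ _)

  module _ where
    open SemiringExp semiring using (_^_)
    open SemiringMult semiring using (_×_)
    open SemiringSum semiring using (sum; sum-cong-≋)
    open Binomial commutativeSemiring using (theorem; binomialExpansion)

    pow≈^ : ∀ x k → pow x k ≈ x ^ k
    pow≈^ x zero    = refl
    pow≈^ x (suc k) = *-congˡ (pow≈^ x k)

    ×≈ι* : ∀ n x → n × x ≈ ι n * x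
    ×≈ι* zero    x = sym (zeroˡ x)
    ×≈ι* (suc n) x = trans (+-cong (sym (*-identityˡ x)) (×≈ι* n x)) (sym (distribʳ _ _ _))

    Σ<≈sum : ∀ n f → Σ< n f ≈ sum {n} (λ i → f (toℕ i))
    Σ<≈sum zero    f = refl
    Σ<≈sum (suc n) f = +-congˡ (Σ<≈sum n (λ a → f (suc a)))

    binomial : ∀ n x y → pow (x + y) n ≈ Σ< (suc n) (λ k → ι (n C k) * (pow x k * pow y (n ∸ k)))
    binomial n x y = begin
      pow (x + y) n            ≈⟨ pow≈^ (x + y) n ⟩
      (x + y) ^ n              ≈⟨ theorem n x y ⟩
      binomialExpansion x y n  ≈⟨ sum-cong-≋ {suc n} (λ i → trans (×≈ι* (n C toℕ i) _)
                                    (*-congˡ (*-cong (sym (pow≈^ x (toℕ i))) (sym (pow≈^ y (n ∸ toℕ i)))))) ⟩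
      sum {suc n} (λ i → ι (n C toℕ i) * (pow x (toℕ i) * pow y (n ∸ toℕ i)))
        ≈⟨ Σ<≈sum (suc n) (λ k → ι (n C k) * (pow x k * pow y (n ∸ k))) ⟨
      Σ< (suc n) (λ k → ι (n C k) * (pow x k * pow y (n ∸ k))) ∎

  trinomial : ∀ n x y z →
    Σ₃ n (λ k l m → ι (multinomial n k l m) * pow x k * pow y l * pow z m) ≈ pow (x + (y + z)) n
  trinomial n x y z = sym (begin
    pow (x + (y + z)) n
      ≈⟨ binomial n x (y + z) ⟩
    Σ< (suc n) (λ k → ι (n C k) * (pow x k * pow (y + z) (n ∸ k)))
      ≈⟨ Σ<-cong (suc n) (λ k → *-congˡ {ι (n C k)} (*-congˡ {pow x k} (binomial (n ∸ k) y z))) ⟩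
    Σ< (suc n) (λ k → ι (n C k) * (pow x k * Σ< (suc (n ∸ k)) (λ l → ι ((n ∸ k) C l) * (pow y l * pow z (n ∸ k ∸ l)))))
      ≈⟨ Σ<-cong (suc n) (λ k → trans (*-congˡ (*-distribˡ-Σ< (suc (n ∸ k)) (pow x k) (binomialTerm (n ∸ k))))
                                       (*-distribˡ-Σ< (suc (n ∸ k)) (ι (n C k)) (λ l → pow x k * binomialTerm (n ∸ k) l))) ⟩
    Σ₃ n (λ k l m → ι (n C k) * (pow x k * (ι ((n ∸ k) C l) * (pow y l * pow z m))))
      ≈⟨ Σ<-cong-< (suc n) (λ k k≤n → Σ<-cong-< (suc (n ∸ k)) (λ l l≤n∸k → term k l k≤n l≤n∸k)) ⟩
    Σ₃ n (λ k l m → ι (multinomial n k l m) * pow x k * pow y l * pow z m) ∎)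
    where
    binomialTerm : ℕ → ℕ → Carrier
    binomialTerm j l = ι (j C l) * (pow y l * pow z (j ∸ l))
    term : ∀ k l → k < suc n → l < suc (n ∸ k) →
           ι (n C k) * (pow x k * (ι ((n ∸ k) C l) * (pow y l * pow z (n ∸ k ∸ l))))
           ≈ ι (multinomial n k l (n ∸ k ∸ l)) * pow x k * pow y l * pow z (n ∸ k ∸ l)
    term k l (s≤s k≤n) (s≤s l≤n∸k) = begin
      ι (n C k) * (pow x k * (ι ((n ∸ k) C l) * (pow y l * pow z (n ∸ k ∸ l))))
        ≈⟨ solve 5 (λ a b c d e → a :* (b :* (c :* (d :* e))) := (a :* c) :* b :* d :* e) refl _ _ _ _ _ ⟩
      ι (n C k) * ι ((n ∸ k) C l) * pow x k * pow y l * pow z (n ∸ k ∸ l)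
        ≈⟨ *-congʳ (*-congʳ (*-congʳ (ι-* (n C k) ((n ∸ k) C l)))) ⟨
      ι ((n C k) ℕ.* ((n ∸ k) C l)) * pow x k * pow y l * pow z (n ∸ k ∸ l)
        ≡⟨ P.cong (λ t → ι t * pow x k * pow y l * pow z (n ∸ k ∸ l)) (multinomial≡C*C k≤n l≤n∸k) ⟨
      ι (multinomial n k l (n ∸ k ∸ l)) * pow x k * pow y l * pow z (n ∸ k ∸ l) ∎

  Σ<*Σ< : ∀ M N (f g : ℕ → Carrier) → Σ< M f * Σ< N g ≈ Σ< M (λ a → Σ< N (λ b → f a * g b))
  Σ<*Σ< M N f g = trans (*-distribʳ-Σ< M (Σ< N g) f) (Σ<-cong M (λ a → *-distribˡ-Σ< N (f a) g))

  Σ<*Σ<*Σ< : ∀ N₁ N₂ N₃ (f g h : ℕ → Carrier) →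
    Σ< N₁ f * Σ< N₂ g * Σ< N₃ h ≈ Σ< N₁ (λ a → Σ< N₂ (λ b → Σ< N₃ (λ c → f a * g b * h c)))
  Σ<*Σ<*Σ< N₁ N₂ N₃ f g h = begin
    Σ< N₁ f * Σ< N₂ g * Σ< N₃ h
      ≈⟨ *-congʳ (Σ<*Σ< N₁ N₂ f g) ⟩
    Σ< N₁ (λ a → Σ< N₂ (λ b → f a * g b)) * Σ< N₃ h
      ≈⟨ *-distribʳ-Σ< N₁ (Σ< N₃ h) _ ⟩
    Σ< N₁ (λ a → Σ< N₂ (λ b → f a * g b) * Σ< N₃ h)
      ≈⟨ Σ<-cong N₁ (λ a → Σ<*Σ< N₂ N₃ (λ b → f a * g b) h) ⟩
    Σ< N₁ (λ a → Σ< N₂ (λ b → Σ< N₃ (λ c → f a * g b * h c))) ∎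

  powerSum : ℕ → (ℕ → Carrier) → (ℕ → Carrier) → ℕ → Carrier
  powerSum N p α k = Σ< N (λ a → p a * pow (α a) k)

  Σ₃-powerSums : ∀ n N₁ N₂ N₃ (p q r α β γ : ℕ → Carrier) →
    Σ₃ n (λ k l m → ι (multinomial n k l m) * powerSum N₁ p α k * powerSum N₂ q β l * powerSum N₃ r γ m)
    ≈ Σ< N₁ (λ a → p a * Σ< N₂ (λ b → q b * Σ< N₃ (λ c → r c * pow (α a + (β b + γ c)) n)))
  Σ₃-powerSums n N₁ N₂ N₃ p q r α β γ = begin
    Σ₃ n (λ k l m → M k l m * powerSum N₁ p α k * powerSum N₂ q β l * powerSum N₃ r γ m)
      ≈⟨ Σ₃-cong n (λ k l m → trans (*-congʳ (*-congʳ (*-distribˡ-Σ< N₁ (M k l m) (A k))))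
                                     (Σ<*Σ<*Σ< N₁ N₂ N₃ (λ a → M k l m * A k a) (B l) (C m))) ⟩
    Σ₃ n (λ k l m → Σ< N₁ (λ a → Σ< N₂ (λ b → Σ< N₃ (λ c → term a b c k l m))))
      ≈⟨ Σ₃-Σ<-swap n N₁ (λ k l m a → Σ< N₂ (λ b → Σ< N₃ (λ c → term a b c k l m))) ⟩
    Σ< N₁ (λ a → Σ₃ n (λ k l m → Σ< N₂ (λ b → Σ< N₃ (λ c → term a b c k l m))))
      ≈⟨ Σ<-cong N₁ (λ a → trans (Σ₃-Σ<-swap n N₂ (λ k l m b → Σ< N₃ (λ c → term a b c k l m)))
                                  (Σ<-cong N₂ (λ b → Σ₃-Σ<-swap n N₃ (λ k l m c → term a b c k l m)))) ⟩
    Σ< N₁ (λ a → Σ< N₂ (λ b → Σ< N₃ (λ c → Σ₃ n (term a b c))))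
      ≈⟨ Σ<-cong N₁ (λ a → Σ<-cong N₂ (λ b → Σ<-cong N₃ (λ c → Σ₃-term a b c))) ⟩
    Σ< N₁ (λ a → Σ< N₂ (λ b → Σ< N₃ (λ c → p a * (q b * (r c * pow (α a + (β b + γ c)) n)))))
      ≈⟨ Σ<-cong N₁ (λ a → Σ<-cong N₂ (λ b → trans
           (sym (*-distribˡ-Σ< N₃ (p a) _)) (*-congˡ (sym (*-distribˡ-Σ< N₃ (q b) _))))) ⟩
    Σ< N₁ (λ a → Σ< N₂ (λ b → p a * (q b * Σ< N₃ (λ c → r c * pow (α a + (β b + γ c)) n))))
      ≈⟨ Σ<-cong N₁ (λ a → sym (*-distribˡ-Σ< N₂ (p a) _)) ⟩
    Σ< N₁ (λ a → p a * Σ< N₂ (λ b → q b * Σ< N₃ (λ c → r c * pow (α a + (β b + γ c)) n))) ∎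
    where
    M : ℕ → ℕ → ℕ → Carrier
    M k l m = ι (multinomial n k l m)
    A B C : ℕ → ℕ → Carrier
    A k a = p a * pow (α a) k
    B l b = q b * pow (β b) l
    C m c = r c * pow (γ c) m
    term : ℕ → ℕ → ℕ → ℕ → ℕ → ℕ → Carrier
    term a b c k l m = M k l m * A k a * B l b * C m c
    Σ₃-term : ∀ a b c → Σ₃ n (term a b c) ≈ p a * (q b * (r c * pow (α a + (β b + γ c)) n))
    Σ₃-term a b c = begin
      Σ₃ n (term a b c)
        ≈⟨ Σ₃-cong n (λ k l m → solve 7
             (λ M x y z p q r → M :* (p :* x) :* (q :* y) :* (r :* z) := p :* (q :* r) :* (M :* x :* y :* z))
             refl (M k l m) (pow (α a) k) (pow (β b) l) (pow (γ c) m) (p a) (q b) (r c)) ⟩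
      Σ₃ n (λ k l m → p a * (q b * r c) * (M k l m * pow (α a) k * pow (β b) l * pow (γ c) m))
        ≈⟨ *-distribˡ-Σ₃ n (p a * (q b * r c)) (λ k l m → M k l m * pow (α a) k * pow (β b) l * pow (γ c) m) ⟨
      p a * (q b * r c) * Σ₃ n (λ k l m → M k l m * pow (α a) k * pow (β b) l * pow (γ c) m)
        ≈⟨ *-congˡ (trinomial n (α a) (β b) (γ c)) ⟩
      p a * (q b * r c) * pow (α a + (β b + γ c)) n
        ≈⟨ solve 4 (λ p q r x → p :* (q :* r) :* x := p :* (q :* (r :* x))) refl (p a) (q b) (r c) _ ⟩
      p a * (q b * (r c * pow (α a + (β b + γ c)) n)) ∎

module ShiftOperators {c ℓ : Level} (R : CommutativeRing c ℓ) where
  open CommutativeRing R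
  open SumsAndPowers R
  open import Relation.Binary.Reasoning.Setoid setoid
  open import Algebra.Properties.Ring ring using (-1*x≈-x)
  open CommutativeSemigroupProperties *-commutativeSemigroup using (x∙yz≈y∙xz)
  open CommutativeSemigroupProperties using (xy∙z≈xz∙y)

  record ShiftSum : Set c where
    constructor shiftSum
    field
      size   : ℕ
      coeff  : ℕ → Carrier
      offset : ℕ → ℕ

  ⟦_⟧ : ShiftSum → (ℕ → Carrier) → ℕ → Carrier
  ⟦ shiftSum N κ σ ⟧ g x = Σ< N (λ a → κ a * g (x ℕ.+ σ a))

  ⟦⟧-cong : ∀ T {g h : ℕ → Carrier} → (∀ y → g y ≈ h y) → ∀ x → ⟦ T ⟧ g x ≈ ⟦ T ⟧ h x
  ⟦⟧-cong (shiftSum N κ σ) g≈h x = Σ<-cong N (λ a → *-congˡ (g≈h _))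

  ⟦⟧-comm : ∀ S T (g : ℕ → Carrier) x → ⟦ S ⟧ (⟦ T ⟧ g) x ≈ ⟦ T ⟧ (⟦ S ⟧ g) x
  ⟦⟧-comm (shiftSum M κ σ) (shiftSum N λ′ τ) g x = begin
    Σ< M (λ a → κ a * Σ< N (λ b → λ′ b * g (x ℕ.+ σ a ℕ.+ τ b)))
      ≈⟨ Σ<-cong M (λ a → *-distribˡ-Σ< N (κ a) _) ⟩
    Σ< M (λ a → Σ< N (λ b → κ a * (λ′ b * g (x ℕ.+ σ a ℕ.+ τ b))))
      ≈⟨ Σ<-swap M N _ ⟩
    Σ< N (λ b → Σ< M (λ a → κ a * (λ′ b * g (x ℕ.+ σ a ℕ.+ τ b))))
      ≈⟨ Σ<-cong N (λ b → Σ<-cong M (λ a → exchange (κ a) (λ′ b) (σ a) (τ b))) ⟩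
    Σ< N (λ b → Σ< M (λ a → λ′ b * (κ a * g (x ℕ.+ τ b ℕ.+ σ a))))
      ≈⟨ Σ<-cong N (λ b → *-distribˡ-Σ< M (λ′ b) _) ⟨
    Σ< N (λ b → λ′ b * Σ< M (λ a → κ a * g (x ℕ.+ τ b ℕ.+ σ a))) ∎
    where
    exchange : ∀ p q i j → p * (q * g (x ℕ.+ i ℕ.+ j)) ≈ q * (p * g (x ℕ.+ j ℕ.+ i))
    exchange p q i j = trans (x∙yz≈y∙xz p q _)
      (reflexive (P.cong (λ t → q * (p * g t)) (xy∙z≈xz∙y ℕₚ.+-commutativeSemigroup x i j)))

  ⟦_⟧* : List ShiftSum → (ℕ → Carrier) → ℕ → Carrier
  ⟦ []     ⟧* g = g
  ⟦ T ∷ Ts ⟧* g = ⟦ T ⟧ (⟦ Ts ⟧* g)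

  ⟦⟧*-cong : ∀ Ts {g h : ℕ → Carrier} → (∀ y → g y ≈ h y) → ∀ x → ⟦ Ts ⟧* g x ≈ ⟦ Ts ⟧* h x
  ⟦⟧*-cong []       g≈h = g≈h
  ⟦⟧*-cong (T ∷ Ts) g≈h = ⟦⟧-cong T (⟦⟧*-cong Ts g≈h)

  ⟦⟧*-↭ : ∀ {Ss Ts} → Ss ↭ Ts → ∀ g x → ⟦ Ss ⟧* g x ≈ ⟦ Ts ⟧* g x
  ⟦⟧*-↭ Perm.refl                 g x = refl
  ⟦⟧*-↭ (Perm.prep T Ss↭Ts)       g x = ⟦⟧-cong T (⟦⟧*-↭ Ss↭Ts g) x
  ⟦⟧*-↭ (Perm.trans Ss↭Ts Ts↭Us)  g x = trans (⟦⟧*-↭ Ss↭Ts g x) (⟦⟧*-↭ Ts↭Us g x)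
  ⟦⟧*-↭ {S ∷ T ∷ Ss} (Perm.swap .S .T Ss↭Ts) g x =
    trans (⟦⟧-comm S T (⟦ Ss ⟧* g) x) (⟦⟧-cong T (⟦⟧-cong S (⟦⟧*-↭ Ss↭Ts g)) x)

  Δ : ℕ → ShiftSum
  Δ m = shiftSum 2 sign step
    where
    sign : ℕ → Carrier
    sign zero    = - 1#
    sign (suc _) = 1#
    step : ℕ → ℕ
    step zero    = 0
    step (suc _) = m

  Δ-apply : ∀ m (g : ℕ → Carrier) y → ⟦ Δ m ⟧ g y ≈ g (y ℕ.+ m) - g y
  Δ-apply m g y = begin
    - 1# * g (y ℕ.+ 0) + (1# * g (y ℕ.+ m) + 0#)
      ≡⟨ P.cong (λ t → - 1# * g t + (1# * g (y ℕ.+ m) + 0#)) (ℕₚ.+-identityʳ y) ⟩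
    - 1# * g y + (1# * g (y ℕ.+ m) + 0#)
      ≈⟨ +-cong (-1*x≈-x _) (trans (+-identityʳ _) (*-identityˡ _)) ⟩
    - g y + g (y ℕ.+ m)
      ≈⟨ +-comm _ _ ⟩
    g (y ℕ.+ m) - g y ∎

  antidifference : ∀ m .{{_ : NonZero m}} → (ℕ → Carrier) → ℕ → Carrier
  antidifference m h x = Σ< (x / m) (λ i → h (x % m ℕ.+ i ℕ.* m))

  Δ-antidifference : ∀ m .{{_ : NonZero m}} h x → ⟦ Δ m ⟧ (antidifference m h) x ≈ h x
  Δ-antidifference m h x = begin
    ⟦ Δ m ⟧ H x
      ≈⟨ Δ-apply m H x ⟩
    H (x ℕ.+ m) - H x
      ≡⟨ P.cong₂ (λ q r → Σ< q (λ i → h (r ℕ.+ i ℕ.* m)) - H x) [x+m]/m≡1+x/m ([m+n]%n≡m%n x m) ⟩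
    Σ< (suc (x / m)) (λ i → h (x % m ℕ.+ i ℕ.* m)) - H x
      ≈⟨ +-congʳ (Σ<-suc (x / m) _) ⟩
    (H x + h (x % m ℕ.+ (x / m) ℕ.* m)) - H x
      ≡⟨ P.cong (λ t → (H x + h t) - H x) (m≡m%n+[m/n]*n x m) ⟨
    (H x + h x) - H x
      ≈⟨ +-congʳ (+-comm _ _) ⟩
    (h x + H x) - H x
      ≈⟨ +-assoc _ _ _ ⟩
    h x + (H x - H x)
      ≈⟨ trans (+-congˡ (-‿inverseʳ _)) (+-identityʳ _) ⟩
    h x ∎
    where
    H = antidifference m h
    [x+m]/m≡1+x/m : (x ℕ.+ m) / m ≡ suc (x / m)
    [x+m]/m≡1+x/m = P.trans (m/n≡1+[m∸n]/n (ℕₚ.m≤n+m m x)) (P.cong (λ t → suc (t / m)) (ℕₚ.m+n∸n≡m x m))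

module CharacterSums {c ℓ : Level} (R : CommutativeRing c ℓ) (d : ℕ)
  (χ : ℕ → CommutativeRing.Carrier R)
  (periodic : ∀ a → CommutativeRing._≈_ R (χ (a ℕ.+ d)) (χ a)) where
  open CommutativeRing R
  open SumsAndPowers R
  open ShiftOperators R
  open import Relation.Binary.Reasoning.Setoid setoid
  open CommutativeSemigroupProperties using (x∙yz≈y∙xz)

  χ-periodic : ∀ j i → χ (j ℕ.* d ℕ.+ i) ≈ χ i
  χ-periodic zero    i = refl
  χ-periodic (suc j) i = trans (reflexive (P.cong χ (shuffle d (j ℕ.* d) i)))
                               (trans (periodic _) (χ-periodic j i))
    where
    shuffle : ∀ d e i → d ℕ.+ e ℕ.+ i ≡ e ℕ.+ i ℕ.+ d
    shuffle = solve-∀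

  χSum : ℕ → ℕ → ShiftSum
  χSum N v = shiftSum N χ (v ℕ.*_)

  -- Split a < u·d into blocks a = j·d + i; by periodicity the sum over j telescopes.
  χSum-Δ : ∀ u v {m} → m ≡ u ℕ.* (v ℕ.* d) → ∀ g x →
           ⟦ χSum (u ℕ.* d) v ⟧ (⟦ Δ (v ℕ.* d) ⟧ g) x ≈ ⟦ χSum d v ⟧ (⟦ Δ m ⟧ g) x
  χSum-Δ u v P.refl g x = begin
    Σ< (u ℕ.* d) (λ a → χ a * ⟦ Δ (v ℕ.* d) ⟧ g (x ℕ.+ v ℕ.* a))
      ≈⟨ Σ<-cong (u ℕ.* d) (λ a → *-congˡ (Δ-apply (v ℕ.* d) g _)) ⟩
    Σ< (u ℕ.* d) (λ a → χ a * (g (x ℕ.+ v ℕ.* a ℕ.+ v ℕ.* d) - g (x ℕ.+ v ℕ.* a)))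
      ≈⟨ Σ<-blocks u d _ ⟩
    Σ< u (λ j → Σ< d (λ i → χ (j ℕ.* d ℕ.+ i) * (g (x ℕ.+ v ℕ.* (j ℕ.* d ℕ.+ i) ℕ.+ v ℕ.* d)
                                                 - g (x ℕ.+ v ℕ.* (j ℕ.* d ℕ.+ i)))))
      ≈⟨ Σ<-cong u (λ j → Σ<-cong d (λ i → *-cong (χ-periodic j i)
           (reflexive (P.cong₂ (λ s t → g s - g t) (next-block x v d j i) (this-block x v d j i))))) ⟩
    Σ< u (λ j → Σ< d (λ i → χ i * (F i (suc j) - F i j)))
      ≈⟨ Σ<-swap u d _ ⟩
    Σ< d (λ i → Σ< u (λ j → χ i * (F i (suc j) - F i j)))
      ≈⟨ Σ<-cong d (λ i → trans (sym (*-distribˡ-Σ< u (χ i) _)) (*-congˡ (Σ<-telescope u (F i)))) ⟩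
    Σ< d (λ i → χ i * (F i u - F i 0))
      ≈⟨ Σ<-cong d (λ i → *-congˡ (trans
           (reflexive (P.cong (λ t → g t - F i 0) (ℕₚ.+-comm (u ℕ.* (v ℕ.* d)) (x ℕ.+ v ℕ.* i))))
           (sym (Δ-apply (u ℕ.* (v ℕ.* d)) g (x ℕ.+ v ℕ.* i))))) ⟩
    Σ< d (λ i → χ i * ⟦ Δ (u ℕ.* (v ℕ.* d)) ⟧ g (x ℕ.+ v ℕ.* i)) ∎
    where
    F : ℕ → ℕ → Carrier
    F i j = g (j ℕ.* (v ℕ.* d) ℕ.+ (x ℕ.+ v ℕ.* i))
    next-block : ∀ x v d j i → x ℕ.+ v ℕ.* (j ℕ.* d ℕ.+ i) ℕ.+ v ℕ.* d ≡ suc j ℕ.* (v ℕ.* d) ℕ.+ (x ℕ.+ v ℕ.* i)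
    next-block = solve-∀
    this-block : ∀ x v d j i → x ℕ.+ v ℕ.* (j ℕ.* d ℕ.+ i) ≡ j ℕ.* (v ℕ.* d) ℕ.+ (x ℕ.+ v ℕ.* i)
    this-block = solve-∀

  -- charSum₃ u₁ u₂ u₃ h = Σ_{a<u₁d, b<u₂d, c<u₃d} χ(a)χ(b)χ(c) h(u₃a + u₁b + u₂c)
  charSum₃ : ℕ → ℕ → ℕ → (ℕ → Carrier) → Carrier
  charSum₃ u₁ u₂ u₃ h = ⟦ χSum (u₁ ℕ.* d) u₃ ∷ χSum (u₂ ℕ.* d) u₁ ∷ χSum (u₃ ℕ.* d) u₂ ∷ [] ⟧* h 0

  charSum₃-Δ : ∀ u₁ u₂ u₃ {s₁₃ s₂₁ s₃₂} →
    s₁₃ ≡ u₁ ℕ.* (u₃ ℕ.* d) → s₂₁ ≡ u₂ ℕ.* (u₁ ℕ.* d) → s₃₂ ≡ u₃ ℕ.* (u₂ ℕ.* d) → ∀ G →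
    charSum₃ u₁ u₂ u₃ (⟦ Δ (u₃ ℕ.* d) ∷ Δ (u₁ ℕ.* d) ∷ Δ (u₂ ℕ.* d) ∷ [] ⟧* G)
    ≈ ⟦ χSum d u₃ ∷ Δ s₁₃ ∷ χSum d u₁ ∷ Δ s₂₁ ∷ χSum d u₂ ∷ Δ s₃₂ ∷ [] ⟧* G 0
  charSum₃-Δ u₁ u₂ u₃ {s₁₃} {s₂₁} {s₃₂} s₁₃≡ s₂₁≡ s₃₂≡ G = begin
    ⟦ K₁ ∷ K₂ ∷ K₃ ∷ Δ₃ ∷ Δ₁ ∷ Δ₂ ∷ [] ⟧* G 0
      ≈⟨ ⟦⟧*-↭ (interleave K₁ K₂ K₃ Δ₃ Δ₁ Δ₂) G 0 ⟩
    ⟦ K₁ ∷ Δ₃ ∷ K₂ ∷ Δ₁ ∷ K₃ ∷ Δ₂ ∷ [] ⟧* G 0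
      ≈⟨ χSum-Δ u₁ u₃ s₁₃≡ (⟦ K₂ ∷ Δ₁ ∷ K₃ ∷ Δ₂ ∷ [] ⟧* G) 0 ⟩
    ⟦ χSum d u₃ ∷ Δ s₁₃ ∷ K₂ ∷ Δ₁ ∷ K₃ ∷ Δ₂ ∷ [] ⟧* G 0
      ≈⟨ ⟦⟧*-cong (χSum d u₃ ∷ Δ s₁₃ ∷ []) (χSum-Δ u₂ u₁ s₂₁≡ (⟦ K₃ ∷ Δ₂ ∷ [] ⟧* G)) 0 ⟩
    ⟦ χSum d u₃ ∷ Δ s₁₃ ∷ χSum d u₁ ∷ Δ s₂₁ ∷ K₃ ∷ Δ₂ ∷ [] ⟧* G 0
      ≈⟨ ⟦⟧*-cong (χSum d u₃ ∷ Δ s₁₃ ∷ χSum d u₁ ∷ Δ s₂₁ ∷ []) (χSum-Δ u₃ u₂ s₃₂≡ G) 0 ⟩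
    ⟦ χSum d u₃ ∷ Δ s₁₃ ∷ χSum d u₁ ∷ Δ s₂₁ ∷ χSum d u₂ ∷ Δ s₃₂ ∷ [] ⟧* G 0 ∎
    where
    K₁ = χSum (u₁ ℕ.* d) u₃
    K₂ = χSum (u₂ ℕ.* d) u₁
    K₃ = χSum (u₃ ℕ.* d) u₂
    Δ₁ = Δ (u₁ ℕ.* d)
    Δ₂ = Δ (u₂ ℕ.* d)
    Δ₃ = Δ (u₃ ℕ.* d)

  charSum₃-swap : ∀ u₁ u₂ u₃ .{{_ : NonZero (u₁ ℕ.* d)}} .{{_ : NonZero (u₂ ℕ.* d)}}
                  .{{_ : NonZero (u₃ ℕ.* d)}} h → charSum₃ u₁ u₂ u₃ h ≈ charSum₃ u₁ u₃ u₂ h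
  charSum₃-swap u₁ u₂ u₃ h = begin
    charSum₃ u₁ u₂ u₃ h
      ≈⟨ ⟦⟧*-cong (K u₁ u₂ u₃) ΔΔΔG≈h 0 ⟨
    charSum₃ u₁ u₂ u₃ (⟦ Δ₃ ∷ Δ₁ ∷ Δ₂ ∷ [] ⟧* G)
      ≈⟨ charSum₃-Δ u₁ u₂ u₃ P.refl P.refl P.refl G ⟩
    ⟦ χSum d u₃ ∷ Δ s₁₃ ∷ χSum d u₁ ∷ Δ s₂₁ ∷ χSum d u₂ ∷ Δ s₃₂ ∷ [] ⟧* G 0
      ≈⟨ ⟦⟧*-↭ (++⁺ʳ (Δ s₃₂ ∷ []) (Perm.↭-sym (↭-reverse (χSum d u₃ ∷ Δ s₁₃ ∷ χSum d u₁ ∷ Δ s₂₁ ∷ χSum d u₂ ∷ [])))) G 0 ⟩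
    ⟦ χSum d u₂ ∷ Δ s₂₁ ∷ χSum d u₁ ∷ Δ s₁₃ ∷ χSum d u₃ ∷ Δ s₃₂ ∷ [] ⟧* G 0
      ≈⟨ charSum₃-Δ u₁ u₃ u₂ (exchange u₂ u₁) (exchange u₁ u₃) (exchange u₃ u₂) G ⟨
    charSum₃ u₁ u₃ u₂ (⟦ Δ₂ ∷ Δ₁ ∷ Δ₃ ∷ [] ⟧* G)
      ≈⟨ ⟦⟧*-cong (K u₁ u₃ u₂) (⟦⟧*-↭ (↭-reverse (Δ₃ ∷ Δ₁ ∷ Δ₂ ∷ [])) G) 0 ⟩
    charSum₃ u₁ u₃ u₂ (⟦ Δ₃ ∷ Δ₁ ∷ Δ₂ ∷ [] ⟧* G)
      ≈⟨ ⟦⟧*-cong (K u₁ u₃ u₂) ΔΔΔG≈h 0 ⟩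
    charSum₃ u₁ u₃ u₂ h ∎
    where
    K : ℕ → ℕ → ℕ → List ShiftSum
    K u₁ u₂ u₃ = χSum (u₁ ℕ.* d) u₃ ∷ χSum (u₂ ℕ.* d) u₁ ∷ χSum (u₃ ℕ.* d) u₂ ∷ []
    Δ₁ = Δ (u₁ ℕ.* d)
    Δ₂ = Δ (u₂ ℕ.* d)
    Δ₃ = Δ (u₃ ℕ.* d)
    s₁₃ = u₁ ℕ.* (u₃ ℕ.* d)
    s₂₁ = u₂ ℕ.* (u₁ ℕ.* d)
    s₃₂ = u₃ ℕ.* (u₂ ℕ.* d)
    exchange : ∀ x y → x ℕ.* (y ℕ.* d) ≡ y ℕ.* (x ℕ.* d)
    exchange x y = x∙yz≈y∙xz ℕₚ.*-commutativeSemigroup x y d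
    G₁ G₂ G : ℕ → Carrier
    G₁ = antidifference (u₃ ℕ.* d) h
    G₂ = antidifference (u₁ ℕ.* d) G₁
    G  = antidifference (u₂ ℕ.* d) G₂
    ΔΔΔG≈h : ∀ y → ⟦ Δ₃ ∷ Δ₁ ∷ Δ₂ ∷ [] ⟧* G y ≈ h y
    ΔΔΔG≈h y = trans
      (⟦⟧-cong Δ₃ (λ z → trans (⟦⟧-cong Δ₁ (Δ-antidifference (u₂ ℕ.* d) G₂) z)
                               (Δ-antidifference (u₁ ℕ.* d) G₁ z)) y)
      (Δ-antidifference (u₃ ℕ.* d) h y)

module CharZero {c ℓ : Level} (F : CharZeroField c ℓ) where
  open CharZeroField F
  open SumsAndPowers commutativeRing
  open import Relation.Binary.Reasoning.Setoid setoid
  open NaturalCoefficients commutativeSemiring (λ _ _ → nothing) using (solve; _:=_; _:*_)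

  ι-nonZero : ∀ w .{{_ : NonZero w}} → ¬ ι w ≈ 0#
  ι-nonZero (suc w) = charZero w

  *-cancelˡ-nonZero : ∀ {x y z} → ¬ x ≈ 0# → x * y ≈ x * z → y ≈ z
  *-cancelˡ-nonZero {x} {y} {z} x≉0 xy≈xz = begin
    y                ≈⟨ *-identityˡ y ⟨
    1# * y           ≈⟨ *-congʳ (trans (*-comm _ _) (inverseʳ x x≉0)) ⟨
    (x ⁻¹ * x) * y   ≈⟨ *-assoc _ _ _ ⟩
    x ⁻¹ * (x * y)   ≈⟨ *-congˡ xy≈xz ⟩
    x ⁻¹ * (x * z)   ≈⟨ *-assoc _ _ _ ⟨
    (x ⁻¹ * x) * z   ≈⟨ *-congʳ (trans (*-comm _ _) (inverseʳ x x≉0)) ⟩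
    1# * z           ≈⟨ *-identityˡ z ⟩
    z                ∎

  wpow*ι : ∀ w .{{_ : NonZero w}} k → wpow F w k * ι w ≈ pow (ι w) k
  wpow*ι w zero    = trans (*-comm _ _) (inverseʳ _ (ι-nonZero w))
  wpow*ι w (suc k) = *-comm _ _

  sum3≈Σ₃ : ∀ n (f : ℕ → ℕ → ℕ → Carrier) → sum3 F n f ≈ Σ₃ n f
  sum3≈Σ₃ n f = trans (sumTo≈Σ< n _) (Σ<-cong (suc n) (λ k → sumTo≈Σ< (n ∸ k) (λ l → f k l (n ∸ k ∸ l))))

  S*pow : ∀ N .{{_ : NonZero N}} k χ v → S F k (N ∸ 1) χ * pow (ι v) k ≈ powerSum N χ (λ a → ι (v ℕ.* a)) k
  S*pow (suc N) k χ v = begin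
    S F k N χ * pow (ι v) k
      ≈⟨ *-congʳ (sumTo≈Σ< N _) ⟩
    Σ< (suc N) (λ a → χ a * pow (ι a) k) * pow (ι v) k
      ≈⟨ *-distribʳ-Σ< (suc N) (pow (ι v) k) (λ a → χ a * pow (ι a) k) ⟩
    Σ< (suc N) (λ a → χ a * pow (ι a) k * pow (ι v) k)
      ≈⟨ Σ<-cong (suc N) (λ a → begin
           χ a * pow (ι a) k * pow (ι v) k    ≈⟨ solve 3 (λ c x y → c :* x :* y := c :* (y :* x)) refl (χ a) _ _ ⟩
           χ a * (pow (ι v) k * pow (ι a) k)  ≈⟨ *-congˡ (pow-distrib-* (ι v) (ι a) k) ⟨
           χ a * pow (ι v * ι a) k            ≈⟨ *-congˡ (pow-cong k (ι-* v a)) ⟨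
           χ a * pow (ι (v ℕ.* a)) k          ∎) ⟩
    powerSum (suc N) χ (λ a → ι (v ℕ.* a)) k ∎

  module _ (d : ℕ) .{{_ : NonZero d}} (χ : ℕ → Carrier) (periodic : ∀ a → χ (a ℕ.+ d) ≈ χ a) where
    open CharacterSums commutativeRing d χ periodic

    weightedTripleSum : ℕ → ℕ → ℕ → ℕ → Carrier
    weightedTripleSum n w₁ w₂ w₃ = sum3 F n (λ k l m →
      ι (multinomial n k l m)
      * S F k (w₁ ℕ.* d ∸ 1) χ * S F l (w₂ ℕ.* d ∸ 1) χ * S F m (w₃ ℕ.* d ∸ 1) χ
      * wpow F w₃ k * wpow F w₁ l * wpow F w₂ m)

    weightedTripleSum≈charSum₃ : ∀ n w₁ w₂ w₃ .{{_ : NonZero w₁}} .{{_ : NonZero w₂}} .{{_ : NonZero w₃}} →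
      ι (w₁ ℕ.* (w₂ ℕ.* w₃)) * weightedTripleSum n w₁ w₂ w₃ ≈ charSum₃ w₁ w₂ w₃ (λ s → pow (ι s) n)
    weightedTripleSum≈charSum₃ n w₁ w₂ w₃ = begin
      ι (w₁ ℕ.* (w₂ ℕ.* w₃)) * sum3 F n f
        ≈⟨ *-congˡ (sum3≈Σ₃ n f) ⟩
      ι (w₁ ℕ.* (w₂ ℕ.* w₃)) * Σ₃ n f
        ≈⟨ *-distribˡ-Σ₃ n _ f ⟩
      Σ₃ n (λ k l m → ι (w₁ ℕ.* (w₂ ℕ.* w₃)) * f k l m)
        ≈⟨ Σ₃-cong n term ⟩
      Σ₃ n (λ k l m → ι (multinomial n k l m) * P₁ k * P₂ l * P₃ m)
        ≈⟨ Σ₃-powerSums n (w₁ ℕ.* d) (w₂ ℕ.* d) (w₃ ℕ.* d) χ χ χ _ _ _ ⟩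
      Σ< (w₁ ℕ.* d) (λ a → χ a * Σ< (w₂ ℕ.* d) (λ b → χ b * Σ< (w₃ ℕ.* d) (λ c → χ c *
        pow (ι (w₃ ℕ.* a) + (ι (w₁ ℕ.* b) + ι (w₂ ℕ.* c))) n)))
        ≈⟨ Σ<-cong (w₁ ℕ.* d) (λ a → *-congˡ (Σ<-cong (w₂ ℕ.* d) (λ b → *-congˡ (Σ<-cong (w₃ ℕ.* d) (λ c →
             *-congˡ (pow-cong n (sym (ι-sum a b c)))))))) ⟩
      charSum₃ w₁ w₂ w₃ (λ s → pow (ι s) n) ∎
      where
      instance
        w₁d≢0 : NonZero (w₁ ℕ.* d)
        w₁d≢0 = m*n≢0 w₁ d
        w₂d≢0 : NonZero (w₂ ℕ.* d)
        w₂d≢0 = m*n≢0 w₂ d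
        w₃d≢0 : NonZero (w₃ ℕ.* d)
        w₃d≢0 = m*n≢0 w₃ d
      f : ℕ → ℕ → ℕ → Carrier
      f k l m = ι (multinomial n k l m)
        * S F k (w₁ ℕ.* d ∸ 1) χ * S F l (w₂ ℕ.* d ∸ 1) χ * S F m (w₃ ℕ.* d ∸ 1) χ
        * wpow F w₃ k * wpow F w₁ l * wpow F w₂ m
      P₁ P₂ P₃ : ℕ → Carrier
      P₁ = powerSum (w₁ ℕ.* d) χ (λ a → ι (w₃ ℕ.* a))
      P₂ = powerSum (w₂ ℕ.* d) χ (λ b → ι (w₁ ℕ.* b))
      P₃ = powerSum (w₃ ℕ.* d) χ (λ c → ι (w₂ ℕ.* c))
      term : ∀ k l m → ι (w₁ ℕ.* (w₂ ℕ.* w₃)) * f k l m ≈ ι (multinomial n k l m) * P₁ k * P₂ l * P₃ m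
      term k l m = begin
        ι (w₁ ℕ.* (w₂ ℕ.* w₃)) * (M * Sk * Sl * Sm * Wk * Wl * Wm)
          ≈⟨ *-congʳ (trans (ι-* w₁ _) (*-congˡ (ι-* w₂ w₃))) ⟩
        ι w₁ * (ι w₂ * ι w₃) * (M * Sk * Sl * Sm * Wk * Wl * Wm)
          ≈⟨ solve 10 (λ i₁ i₂ i₃ M a b c x y z → i₁ :* (i₂ :* i₃) :* (M :* a :* b :* c :* x :* y :* z)
                         := M :* (a :* (x :* i₃)) :* (b :* (y :* i₁)) :* (c :* (z :* i₂)))
               refl (ι w₁) (ι w₂) (ι w₃) M Sk Sl Sm Wk Wl Wm ⟩
        M * (Sk * (Wk * ι w₃)) * (Sl * (Wl * ι w₁)) * (Sm * (Wm * ι w₂))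
          ≈⟨ *-cong (*-cong (*-congˡ (*-congˡ (wpow*ι w₃ k))) (*-congˡ (wpow*ι w₁ l))) (*-congˡ (wpow*ι w₂ m)) ⟩
        M * (Sk * pow (ι w₃) k) * (Sl * pow (ι w₁) l) * (Sm * pow (ι w₂) m)
          ≈⟨ *-cong (*-cong (*-congˡ (S*pow (w₁ ℕ.* d) k χ w₃)) (S*pow (w₂ ℕ.* d) l χ w₁)) (S*pow (w₃ ℕ.* d) m χ w₂) ⟩
        M * P₁ k * P₂ l * P₃ m ∎
        where
        M  = ι (multinomial n k l m)
        Sk = S F k (w₁ ℕ.* d ∸ 1) χ
        Sl = S F l (w₂ ℕ.* d ∸ 1) χ
        Sm = S F m (w₃ ℕ.* d ∸ 1) χ
        Wk = wpow F w₃ k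
        Wl = wpow F w₁ l
        Wm = wpow F w₂ m
      ι-sum : ∀ a b c → ι (0 ℕ.+ w₃ ℕ.* a ℕ.+ w₁ ℕ.* b ℕ.+ w₂ ℕ.* c) ≈ ι (w₃ ℕ.* a) + (ι (w₁ ℕ.* b) + ι (w₂ ℕ.* c))
      ι-sum a b c = begin
        ι (w₃ ℕ.* a ℕ.+ w₁ ℕ.* b ℕ.+ w₂ ℕ.* c)        ≈⟨ ι-+ (w₃ ℕ.* a ℕ.+ w₁ ℕ.* b) (w₂ ℕ.* c) ⟩
        ι (w₃ ℕ.* a ℕ.+ w₁ ℕ.* b) + ι (w₂ ℕ.* c)      ≈⟨ +-congʳ (ι-+ (w₃ ℕ.* a) (w₁ ℕ.* b)) ⟩
        ι (w₃ ℕ.* a) + ι (w₁ ℕ.* b) + ι (w₂ ℕ.* c)    ≈⟨ +-assoc _ _ _ ⟩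
        ι (w₃ ℕ.* a) + (ι (w₁ ℕ.* b) + ι (w₂ ℕ.* c))  ∎

    weightedTripleSum-swap : ∀ n w₁ w₂ w₃ .{{_ : NonZero w₁}} .{{_ : NonZero w₂}} .{{_ : NonZero w₃}} →
                             weightedTripleSum n w₁ w₂ w₃ ≈ weightedTripleSum n w₁ w₃ w₂
    weightedTripleSum-swap n w₁ w₂ w₃ = *-cancelˡ-nonZero (ι-nonZero (w₁ ℕ.* (w₂ ℕ.* w₃))) (begin
      ι (w₁ ℕ.* (w₂ ℕ.* w₃)) * weightedTripleSum n w₁ w₂ w₃  ≈⟨ weightedTripleSum≈charSum₃ n w₁ w₂ w₃ ⟩
      charSum₃ w₁ w₂ w₃ h                                     ≈⟨ charSum₃-swap w₁ w₂ w₃ h ⟩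
      charSum₃ w₁ w₃ w₂ h                                     ≈⟨ weightedTripleSum≈charSum₃ n w₁ w₃ w₂ ⟨
      ι (w₁ ℕ.* (w₃ ℕ.* w₂)) * weightedTripleSum n w₁ w₃ w₂
        ≡⟨ P.cong (λ t → ι (w₁ ℕ.* t) * weightedTripleSum n w₁ w₃ w₂) (ℕₚ.*-comm w₃ w₂) ⟩
      ι (w₁ ℕ.* (w₂ ℕ.* w₃)) * weightedTripleSum n w₁ w₃ w₂  ∎)
      where
      h : ℕ → Carrier
      h s = pow (ι s) n
      instance
        w₂w₃≢0 : NonZero (w₂ ℕ.* w₃)
        w₂w₃≢0 = m*n≢0 w₂ w₃
        w₁w₂w₃≢0 : NonZero (w₁ ℕ.* (w₂ ℕ.* w₃))
        w₁w₂w₃≢0 = m*n≢0 w₁ (w₂ ℕ.* w₃)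
        w₁d≢0 : NonZero (w₁ ℕ.* d)
        w₁d≢0 = m*n≢0 w₁ d
        w₂d≢0 : NonZero (w₂ ℕ.* d)
        w₂d≢0 = m*n≢0 w₂ d
        w₃d≢0 : NonZero (w₃ ℕ.* d)
        w₃d≢0 = m*n≢0 w₃ d

theorem8 : ∀ {c ℓ : Level} (F : CharZeroField c ℓ) →
    let open CharZeroField F in
    (d : ℕ) → d > 0 → (χ : ℕ → Carrier) → IsPrimitiveCharacter F d χ →
    (w₁ w₂ w₃ : ℕ) → w₁ > 0 → w₂ > 0 → w₃ > 0 → (n : ℕ) →
    sum3 F n (λ k l m →
        ι (multinomial n k l m)
        * S F k (w₁ ℕ.* d ∸ 1) χ * S F l (w₂ ℕ.* d ∸ 1) χ * S F m (w₃ ℕ.* d ∸ 1) χ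
        * wpow F w₃ k * wpow F w₁ l * wpow F w₂ m)
    ≈
    sum3 F n (λ k l m →
        ι (multinomial n k l m)
        * S F k (w₁ ℕ.* d ∸ 1) χ * S F l (w₃ ℕ.* d ∸ 1) χ * S F m (w₂ ℕ.* d ∸ 1) χ
        * wpow F w₂ k * wpow F w₁ l * wpow F w₃ m)
theorem8 F d d>0 χ χ-primitive w₁ w₂ w₃ w₁>0 w₂>0 w₃>0 n =
  CharZero.weightedTripleSum-swap F d {{>-nonZero d>0}} χ periodic n w₁ w₂ w₃
    {{>-nonZero w₁>0}} {{>-nonZero w₂>0}} {{>-nonZero w₃>0}}
  where
  open IsDirichletCharacter (IsPrimitiveCharacter.isCharacter χ-primitive) using (periodic)
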